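{- Let $r:\mathcal{B}\to\mathcal{A}$ be a fibration and let $U:\mathcal{E}\to\mathcal{B}$ be a fibred Lawvere category above $r$. Let $a$ be an object of $\mathcal{A}$ and $F:\mathcal{B}_a\to\mathcal{B}_a$ a functor whose initial algebra has carrier $\mu F$. Then any $K_a$-preserving lifting $\hat F:\mathcal{E}_a\to\mathcal{E}_a$ of $F$ with respect to $U_a$ defines a sound induction rule for $\mu F$. In particular, the lifting $\hat F=I_a\,F^{\to}\,\pi_a$, i.e. $\hat F P=\Sigma_{F(\pi_P)}K_aF\{P\}_a$, defines a sound induction rule for $\mu F$.
   Context: Fibrations, cartesian morphisms, opfibrations (opreindexing $\Sigma_f\dashv f^*$), bifibrations and fibres are as usual; a morphism is vertical if it lies above an identity. A truth functor $K:\mathcal{B}\to\mathcal{E}$ for a fibration $U$ sends $X$ to a terminal object of the fibre $\mathcal{E}_X$, these being preserved by reindexing. A CCU is a fibration whose truth functor has a right adjoint (comprehension functor). For fibrations $U:\mathcal{E}\to\mathcal{B}$, $r:\mathcal{B}\to\mathcal{A}$: $U$ is a fibred CCU above $r$ if $U$ has a truth functor $K$ and $K$ has a right adjoint $\{ -\}$ such that $K$ and $\{ -\}$ are fibred functors between $r$ and $rU$ (preserving cartesian morphisms and commuting with the projections to $\mathcal{A}$) and the unit of $K\dashv\{ -\}$ is vertical with respect to $r$; $U$ is a fibred Lawvere category above $r$ if moreover $U$ is a bifibration. For $a$ in $\mathcal{A}$, $\mathcal{B}_a$ is the fibre of $r$ above $a$, $\mathcal{E}_a$ the fibre of $rU$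 above $a$, $U_a:\mathcal{E}_a\to\mathcal{B}_a$ the restriction of $U$, $K_a$ and $\{ -\}_a$ the restrictions of $K$ and $\{ -\}$, and $\epsilon$ the counit of $K_a\dashv\{ -\}_a$; $\pi_P=U_a(\epsilon_P):\{P\}_a\to U_aP$. $F^{\to}$ is the functor on the arrow category of $\mathcal{B}_a$ applying $F$ to arrows, $\pi_a:\mathcal{E}_a\to\mathcal{B}_a^{\to}$ sends $P$ to $\pi_P$, and $I_a(f:X\to Y)=\Sigma_fK_aX$ (opreindexing for $U_a$). A $K_a$-preserving lifting of $F$ is $\hat F:\mathcal{E}_a\to\mathcal{E}_a$ with $U_a\hat F=FU_a$ and $K_aF\cong\hat FK_a$; it defines a sound induction rule for $\mu F$ if the functor from $F$-algebras to $\hat F$-algebras sending $\alpha:FX\to X$ to $\hat FK_aX\cong K_aFX\xrightarrow{K_a\alpha}K_aX$ preserves initial objects. -}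

module Defs where

open import Level using (Level; _⊔_) renaming (suc to lsuc)
open import Relation.Binary.PropositionalEquality
open import Data.Product using (Σ; _×_; _,_; proj₁; proj₂; Σ-syntax)

uip : ∀ {a} {A : Set a} {x y : A} (p q : x ≡ y) → p ≡ q
uip refl refl = refl

record Category (o ℓ : Level) : Set (lsuc (o ⊔ ℓ)) where
  infixr 9 _∘_
  infix 4 _⇒_
  field
    Obj : Set o
    _⇒_ : Obj → Obj → Set ℓ
    id  : ∀ {X} → X ⇒ X
    _∘_ : ∀ {X Y Z} → Y ⇒ Z → X ⇒ Y → X ⇒ Z
    identityˡ : ∀ {X Y} {f : X ⇒ Y} → id ∘ f ≡ f
    identityʳ : ∀ {X Y} {f : X ⇒ Y} → f ∘ id ≡ f
    assoc : ∀ {W X Y Z} {f : W ⇒ X} {g : X ⇒ Y} {h : Y ⇒ Z} →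
            (h ∘ g) ∘ f ≡ h ∘ (g ∘ f)

  ≡⇒ : ∀ {X Y} → X ≡ Y → X ⇒ Y
  ≡⇒ refl = id

  IsPath : ∀ {X Y} → X ⇒ Y → Set (o ⊔ ℓ)
  IsPath {X} {Y} f = Σ[ p ∈ X ≡ Y ] f ≡ ≡⇒ p

  IsTerminal : Obj → Set (o ⊔ ℓ)
  IsTerminal T = ∀ X → Σ[ h ∈ X ⇒ T ] (∀ (h' : X ⇒ T) → h' ≡ h)

module CatLemmas {o ℓ} (C : Category o ℓ) where
  open Category C

  ≡⇒-trans : ∀ {X Y Z} (p : X ≡ Y) (q : Y ≡ Z) → ≡⇒ (trans p q) ≡ ≡⇒ q ∘ ≡⇒ p
  ≡⇒-trans refl refl = sym identityˡ

  path-resp : ∀ {X Y} {f g : X ⇒ Y} → f ≡ g → IsPath f → IsPath g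
  path-resp refl q = q

  path-id : ∀ {X} → IsPath (id {X})
  path-id = refl , refl

  path-≡⇒ : ∀ {X Y} (p : X ≡ Y) → IsPath (≡⇒ p)
  path-≡⇒ p = p , refl

  path-∘ : ∀ {X Y Z} {g : Y ⇒ Z} {f : X ⇒ Y} → IsPath g → IsPath f → IsPath (g ∘ f)
  path-∘ (q , eg) (p , ef) = trans p q , trans (cong₂ _∘_ eg ef) (sym (≡⇒-trans p q))

  path-unique : ∀ {X Y} {f g : X ⇒ Y} → IsPath f → IsPath g → f ≡ g
  path-unique (p , ef) (q , eg) rewrite uip p q = trans ef (sym eg)

  ≡⇒-symʳ : ∀ {X Y} (p : X ≡ Y) → ≡⇒ p ∘ ≡⇒ (sym p) ≡ id
  ≡⇒-symʳ refl = identityˡ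

  ≡⇒-symˡ : ∀ {X Y} (p : X ≡ Y) → ≡⇒ (sym p) ∘ ≡⇒ p ≡ id
  ≡⇒-symˡ refl = identityˡ

  path-cancelʳ : ∀ {X Y Z} {g : Y ⇒ Z} {f : X ⇒ Y} → IsPath (g ∘ f) → IsPath f → IsPath g
  path-cancelʳ {g = g} {f} pgf (p , ef) =
    path-resp eq (path-∘ pgf (path-≡⇒ (sym p)))
    where
    eq : (g ∘ f) ∘ ≡⇒ (sym p) ≡ g
    eq = trans assoc (trans (cong (λ k → g ∘ (k ∘ ≡⇒ (sym p))) ef)
           (trans (cong (g ∘_) (≡⇒-symʳ p)) identityʳ))

  path-cancelˡ : ∀ {X Y Z} {g : Y ⇒ Z} {f : X ⇒ Y} → IsPath (g ∘ f) → IsPath g → IsPath f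
  path-cancelˡ {g = g} {f} pgf (q , eg) =
    path-resp eq (path-∘ (path-≡⇒ (sym q)) pgf)
    where
    eq : ≡⇒ (sym q) ∘ (g ∘ f) ≡ f
    eq = trans (sym assoc) (trans (cong (λ k → (≡⇒ (sym q) ∘ k) ∘ f) eg)
           (trans (cong (_∘ f) (≡⇒-symˡ q)) identityˡ))

  ≡⇒-cancel : ∀ {X Y Y'} (q : Y ≡ Y') (h : X ⇒ Y) (k : X ⇒ Y') →
              ≡⇒ q ∘ h ≡ k → h ≡ ≡⇒ (sym q) ∘ k
  ≡⇒-cancel refl h k e = trans (sym identityˡ) (trans e (sym identityˡ))

  ≡⇒-conj : ∀ {X X' Y Y'} (p : X ≡ X') (q : Y ≡ Y') (h : X ⇒ Y) (k : X' ⇒ Y') →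
            ≡⇒ q ∘ h ≡ k ∘ ≡⇒ p → h ∘ ≡⇒ (sym p) ≡ ≡⇒ (sym q) ∘ k
  ≡⇒-conj refl refl h k e =
    trans identityʳ (trans (sym identityˡ) (trans e (trans identityʳ (sym identityˡ))))

  ≡⇒-sandwich : ∀ {A₁ A₂ B₁ B₂ C₁ C₂} (p : A₁ ≡ A₂) (q : B₁ ≡ B₂) (r : C₁ ≡ C₂)
                (t : A₂ ⇒ B₂) (t' : B₂ ⇒ C₂) →
                (≡⇒ (sym r) ∘ (t' ∘ ≡⇒ q)) ∘ (≡⇒ (sym q) ∘ (t ∘ ≡⇒ p))
                  ≡ ≡⇒ (sym r) ∘ ((t' ∘ t) ∘ ≡⇒ p)
  ≡⇒-sandwich refl refl refl t t' =
    trans assoc (cong (id ∘_) (trans (cong (_∘ (id ∘ (t ∘ id))) identityʳ)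
      (trans (cong (t' ∘_) identityˡ) (sym assoc))))

record Functor {oC ℓC oD ℓD} (C : Category oC ℓC) (D : Category oD ℓD)
       : Set (oC ⊔ ℓC ⊔ oD ⊔ ℓD) where
  private
    module C = Category C
    module D = Category D
  field
    F₀ : C.Obj → D.Obj
    F₁ : ∀ {X Y} → X C.⇒ Y → F₀ X D.⇒ F₀ Y
    identity : ∀ {X} → F₁ (C.id {X}) ≡ D.id
    homomorphism : ∀ {X Y Z} {f : X C.⇒ Y} {g : Y C.⇒ Z} →
                   F₁ (g C.∘ f) ≡ F₁ g D.∘ F₁ f

IdF : ∀ {o ℓ} (C : Category o ℓ) → Functor C C
IdF C = record { F₀ = λ X → X ; F₁ = λ f → f ; identity = refl ; homomorphism = refl }

infixr 9 _∘F_
_∘F_ : ∀ {o₁ ℓ₁ o₂ ℓ₂ o₃ ℓ₃} {C : Category o₁ ℓ₁} {D : Category o₂ ℓ₂}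
         {E : Category o₃ ℓ₃} → Functor D E → Functor C D → Functor C E
_∘F_ {E = E} G F = record
  { F₀ = λ X → G.F₀ (F.F₀ X)
  ; F₁ = λ f → G.F₁ (F.F₁ f)
  ; identity = trans (cong G.F₁ F.identity) G.identity
  ; homomorphism = trans (cong G.F₁ F.homomorphism) G.homomorphism
  }
  where
  module G = Functor G
  module F = Functor F

-- strict equality of functors (equal on objects, and on morphisms up to the
-- induced transports)
record _≃F_ {oC ℓC oD ℓD} {C : Category oC ℓC} {D : Category oD ℓD}
            (F G : Functor C D) : Set (oC ⊔ ℓC ⊔ oD ⊔ ℓD) where
  private
    module C = Category C
    module D = Category D
    module F = Functor F
    module G = Functor G
  field
    eq₀ : ∀ X → F.F₀ X ≡ G.F₀ X
    eq₁ : ∀ {X Y} (f : X C.⇒ Y) →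
          D.≡⇒ (eq₀ Y) D.∘ F.F₁ f ≡ G.F₁ f D.∘ D.≡⇒ (eq₀ X)

record NatIso {oC ℓC oD ℓD} {C : Category oC ℓC} {D : Category oD ℓD}
              (F G : Functor C D) : Set (oC ⊔ ℓC ⊔ oD ⊔ ℓD) where
  private
    module C = Category C
    module D = Category D
    module F = Functor F
    module G = Functor G
  field
    η   : ∀ X → F.F₀ X D.⇒ G.F₀ X
    η⁻¹ : ∀ X → G.F₀ X D.⇒ F.F₀ X
    commute : ∀ {X Y} (f : X C.⇒ Y) → η Y D.∘ F.F₁ f ≡ G.F₁ f D.∘ η X
    isoˡ : ∀ X → η⁻¹ X D.∘ η X ≡ D.id
    isoʳ : ∀ X → η X D.∘ η⁻¹ X ≡ D.id

record Adjunction {oC ℓC oD ℓD} {C : Category oC ℓC} {D : Category oD ℓD}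
                  (L : Functor C D) (R : Functor D C) : Set (oC ⊔ ℓC ⊔ oD ⊔ ℓD) where
  private
    module C = Category C
    module D = Category D
    module L = Functor L
    module R = Functor R
  field
    unit   : ∀ X → X C.⇒ R.F₀ (L.F₀ X)
    counit : ∀ Y → L.F₀ (R.F₀ Y) D.⇒ Y
    unit-natural : ∀ {X X'} (f : X C.⇒ X') →
                   unit X' C.∘ f ≡ R.F₁ (L.F₁ f) C.∘ unit X
    counit-natural : ∀ {Y Y'} (g : Y D.⇒ Y') →
                     counit Y' D.∘ L.F₁ (R.F₁ g) ≡ g D.∘ counit Y
    zig : ∀ X → counit (L.F₀ X) D.∘ L.F₁ (unit X) ≡ D.id
    zag : ∀ Y → R.F₁ (counit Y) C.∘ unit (R.F₀ Y) ≡ C.id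

module FunctorLemmas {oC ℓC oD ℓD} {C : Category oC ℓC} {D : Category oD ℓD} where
  private
    module C = Category C
    module D = Category D
    module CL = CatLemmas C
    module DL = CatLemmas D

  F-≡⇒ : (F : Functor C D) → ∀ {X Y} (p : X ≡ Y) →
         Functor.F₁ F (C.≡⇒ p) ≡ D.≡⇒ (cong (Functor.F₀ F) p)
  F-≡⇒ F refl = Functor.identity F

  path-F : (F : Functor C D) → ∀ {X Y} {f : X C.⇒ Y} → C.IsPath f → D.IsPath (Functor.F₁ F f)
  path-F F (p , e) = cong (Functor.F₀ F) p , trans (cong (Functor.F₁ F) e) (F-≡⇒ F p)

  ≃-path→ : {F G : Functor C D} → F ≃F G → ∀ {X Y} {f : X C.⇒ Y} →
            D.IsPath (Functor.F₁ F f) → D.IsPath (Functor.F₁ G f)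
  ≃-path→ {F} {G} e {X} {Y} {f} pf =
    DL.path-cancelʳ (DL.path-resp (_≃F_.eq₁ e f) (DL.path-∘ (DL.path-≡⇒ (_≃F_.eq₀ e Y)) pf))
                    (DL.path-≡⇒ (_≃F_.eq₀ e X))

  ≃-path← : {F G : Functor C D} → F ≃F G → ∀ {X Y} {f : X C.⇒ Y} →
            D.IsPath (Functor.F₁ G f) → D.IsPath (Functor.F₁ F f)
  ≃-path← {F} {G} e {X} {Y} {f} pg =
    DL.path-cancelˡ (DL.path-resp (sym (_≃F_.eq₁ e f)) (DL.path-∘ pg (DL.path-≡⇒ (_≃F_.eq₀ e X))))
                    (DL.path-≡⇒ (_≃F_.eq₀ e Y))

≃F-refl : ∀ {oC ℓC oD ℓD} {C : Category oC ℓC} {D : Category oD ℓD}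
          (F : Functor C D) → F ≃F F
≃F-refl {D = D} F = record
  { eq₀ = λ _ → refl
  ; eq₁ = λ _ → trans (Category.identityˡ D) (sym (Category.identityʳ D)) }

module _ {o ℓ} (C : Category o ℓ) where
  private
    module C = Category C

  ArrObj : Set (o ⊔ ℓ)
  ArrObj = Σ[ X ∈ C.Obj ] Σ[ Y ∈ C.Obj ] (X C.⇒ Y)

  record ArrHom (x y : ArrObj) : Set ℓ where
    constructor square
    field
      dom : proj₁ x C.⇒ proj₁ y
      cod : proj₁ (proj₂ x) C.⇒ proj₁ (proj₂ y)
      comm : cod C.∘ proj₂ (proj₂ x) ≡ proj₂ (proj₂ y) C.∘ dom

  Arr-ext : ∀ {x y : ArrObj} {s s' t t'} {q q'} → s ≡ s' → t ≡ t' →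
            _≡_ {A = ArrHom x y} (square s t q) (square s' t' q')
  Arr-ext {q = q} {q'} refl refl rewrite uip q q' = refl

  Arr : Category (o ⊔ ℓ) ℓ
  Arr = record
    { Obj = ArrObj
    ; _⇒_ = ArrHom
    ; id = square C.id C.id (trans C.identityˡ (sym C.identityʳ))
    ; _∘_ = comp
    ; identityˡ = Arr-ext C.identityˡ C.identityˡ
    ; identityʳ = Arr-ext C.identityʳ C.identityʳ
    ; assoc = Arr-ext C.assoc C.assoc
    }
    where
    comp : ∀ {x y z} → ArrHom y z → ArrHom x y → ArrHom x z
    comp (square s' t' q') (square s t q) =
      square (s' C.∘ s) (t' C.∘ t)
        (trans C.assoc (trans (cong (t' C.∘_) q) (trans (sym C.assoc)
          (trans (cong (C._∘ s) q') C.assoc))))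

Arrow : ∀ {oC ℓC oD ℓD} {C : Category oC ℓC} {D : Category oD ℓD} →
        Functor C D → Functor (Arr C) (Arr D)
Arrow {C = C} {D} F = record
  { F₀ = λ { (X , Y , f) → F.F₀ X , F.F₀ Y , F.F₁ f }
  ; F₁ = λ { (square s t q) → square (F.F₁ s) (F.F₁ t)
               (trans (sym F.homomorphism) (trans (cong F.F₁ q) F.homomorphism)) }
  ; identity = Arr-ext D F.identity F.identity
  ; homomorphism = Arr-ext D F.homomorphism F.homomorphism
  }
  where
  module F = Functor F

-- Initial algebras (initial objects of the category of F-algebras, unfolded)

IsInitialAlgebra : ∀ {o ℓ} (C : Category o ℓ) (F : Functor C C) →
                   (X : Category.Obj C) → Category._⇒_ C (Functor.F₀ F X) X → Set (o ⊔ ℓ)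
IsInitialAlgebra C F X α =
  ∀ (Y : C.Obj) (β : Functor.F₀ F Y C.⇒ Y) →
    Σ[ h ∈ X C.⇒ Y ] ((h C.∘ α ≡ β C.∘ Functor.F₁ F h) ×
                      (∀ (h' : X C.⇒ Y) → h' C.∘ α ≡ β C.∘ Functor.F₁ F h' → h' ≡ h))
  where module C = Category C

module _ {oE ℓE oB ℓB} {E : Category oE ℓE} {B : Category oB ℓB} (P : Functor E B) where
  private
    module E = Category E
    module B = Category B
    module P = Functor P
    module BL = CatLemmas B

  IsCartesian : ∀ {Y Z} → Y E.⇒ Z → Set (oE ⊔ ℓE ⊔ ℓB)
  IsCartesian {Y} {Z} f =
    ∀ {W} (g : W E.⇒ Z) (u : P.F₀ W B.⇒ P.F₀ Y) → P.F₁ f B.∘ u ≡ P.F₁ g →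
      Σ[ h ∈ W E.⇒ Y ] ((P.F₁ h ≡ u × f E.∘ h ≡ g) ×
                        (∀ (h' : W E.⇒ Y) → P.F₁ h' ≡ u → f E.∘ h' ≡ g → h' ≡ h))

  IsCocartesian : ∀ {Y Z} → Y E.⇒ Z → Set (oE ⊔ ℓE ⊔ ℓB)
  IsCocartesian {Y} {Z} f =
    ∀ {W} (g : Y E.⇒ W) (u : P.F₀ Z B.⇒ P.F₀ W) → u B.∘ P.F₁ f ≡ P.F₁ g →
      Σ[ h ∈ Z E.⇒ W ] ((P.F₁ h ≡ u × h E.∘ f ≡ g) ×
                        (∀ (h' : Z E.⇒ W) → P.F₁ h' ≡ u → h' E.∘ f ≡ g → h' ≡ h))

  IsFibration : Set (oE ⊔ ℓE ⊔ oB ⊔ ℓB)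
  IsFibration =
    ∀ {I} (Z : E.Obj) (u : I B.⇒ P.F₀ Z) →
      Σ[ Y ∈ E.Obj ] Σ[ f ∈ Y E.⇒ Z ]
        (IsCartesian f × Σ[ e ∈ P.F₀ Y ≡ I ] (P.F₁ f ≡ u B.∘ B.≡⇒ e))

  IsOpfibration : Set (oE ⊔ ℓE ⊔ oB ⊔ ℓB)
  IsOpfibration =
    ∀ {J} (Y : E.Obj) (u : P.F₀ Y B.⇒ J) →
      Σ[ Z ∈ E.Obj ] Σ[ f ∈ Y E.⇒ Z ]
        (IsCocartesian f × Σ[ e ∈ P.F₀ Z ≡ J ] (B.≡⇒ e B.∘ P.F₁ f ≡ u))

  IsBifibration : Set (oE ⊔ ℓE ⊔ oB ⊔ ℓB)
  IsBifibration = IsFibration × IsOpfibration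

  IsVertical : ∀ {X Y} → X E.⇒ Y → Set (oB ⊔ ℓB)
  IsVertical f = B.IsPath (P.F₁ f)

  FibreObj : B.Obj → Set (oE ⊔ oB)
  FibreObj I = Σ[ X ∈ E.Obj ] P.F₀ X ≡ I

  record FibreHom {I} (x y : FibreObj I) : Set (ℓE ⊔ ℓB) where
    constructor fhom
    field
      mor : proj₁ x E.⇒ proj₁ y
      over-id : B.≡⇒ (proj₂ y) B.∘ P.F₁ mor ≡ B.≡⇒ (proj₂ x)

  abstract
    fibre-toPath : ∀ {I} {x y : FibreObj I} (f : FibreHom x y) → B.IsPath (P.F₁ (FibreHom.mor f))
    fibre-toPath {x = X , eX} {Y , eY} (fhom f e) =
      BL.path-cancelˡ (BL.path-resp (sym e) (BL.path-≡⇒ eX)) (BL.path-≡⇒ eY)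

    fibre-fromPath : ∀ {I} {x y : FibreObj I} (f : proj₁ x E.⇒ proj₁ y) →
                     B.IsPath (P.F₁ f) → B.≡⇒ (proj₂ y) B.∘ P.F₁ f ≡ B.≡⇒ (proj₂ x)
    fibre-fromPath {x = X , eX} {Y , eY} f pf =
      BL.path-unique (BL.path-∘ (BL.path-≡⇒ eY) pf) (BL.path-≡⇒ eX)

  fibre-ext : ∀ {I} {x y : FibreObj I} {f g : FibreHom x y} → FibreHom.mor f ≡ FibreHom.mor g → f ≡ g
  fibre-ext {f = fhom f p} {fhom .f q} refl rewrite uip p q = refl

  Fibre : B.Obj → Category (oE ⊔ oB) (ℓE ⊔ ℓB)
  Fibre I = record
    { Obj = FibreObj I
    ; _⇒_ = FibreHom
    ; id = λ {x} → fhom E.id (fibre-fromPath {x = x} {x} E.id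
                              (BL.path-resp (sym P.identity) BL.path-id))
    ; _∘_ = λ {x} {y} {z} g f → fhom
              (FibreHom.mor g E.∘ FibreHom.mor f)
              (fibre-fromPath {x = x} {z} _
                (BL.path-resp (sym P.homomorphism)
                  (BL.path-∘ (fibre-toPath {x = y} {z} g) (fibre-toPath {x = x} {y} f))))
    ; identityˡ = fibre-ext E.identityˡ
    ; identityʳ = fibre-ext E.identityʳ
    ; assoc = fibre-ext E.assoc
    }

module _ {oX ℓX oY ℓY oA ℓA} {X : Category oX ℓX} {Y : Category oY ℓY} {A : Category oA ℓA}
         (p : Functor X A) (q : Functor Y A) (G : Functor X Y)
         (comm : (q ∘F G) ≃F p) where
  private
    module G = Functor G

  restrict : (a : Category.Obj A) → Functor (Fibre p a) (Fibre q a)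
  restrict a = record
    { F₀ = λ { (x , e) → G.F₀ x , trans (_≃F_.eq₀ comm x) e }
    ; F₁ = λ {x} {y} f → fhom (G.F₁ (FibreHom.mor f)) (
             fibre-fromPath q {x = G.F₀ (proj₁ x) , trans (_≃F_.eq₀ comm (proj₁ x)) (proj₂ x)}
                              {G.F₀ (proj₁ y) , trans (_≃F_.eq₀ comm (proj₁ y)) (proj₂ y)} _
               (FunctorLemmas.≃-path← comm (fibre-toPath p {x = x} {y} f)))
    ; identity = fibre-ext q G.identity
    ; homomorphism = fibre-ext q G.homomorphism
    }

module _ {oE ℓE oB ℓB} {E : Category oE ℓE} {B : Category oB ℓB} where
  private
    module E = Category E
    module B = Category B

  -- K X is terminal in the fibre over X, and this is preserved by reindexing
  -- (any cartesian morphism into some K Y has a terminal domain in its fibre)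
  record IsTruthFunctor (U : Functor E B) (K : Functor B E) : Set (oE ⊔ ℓE ⊔ oB ⊔ ℓB) where
    field
      over : (U ∘F K) ≃F IdF B
      terminal : ∀ (X : B.Obj) →
                 Category.IsTerminal (Fibre U X) (Functor.F₀ K X , _≃F_.eq₀ over X)
      stable : ∀ {Y : B.Obj} {Q : E.Obj} (f : Q E.⇒ Functor.F₀ K Y) → IsCartesian U f →
               Category.IsTerminal (Fibre U (Functor.F₀ U Q)) (Q , refl)

module _ {oX ℓX oY ℓY oA ℓA} {X : Category oX ℓX} {Y : Category oY ℓY} {A : Category oA ℓA} where
  record IsFibredFunctor (p : Functor X A) (q : Functor Y A) (G : Functor X Y)
         : Set (oX ⊔ ℓX ⊔ oY ⊔ ℓY ⊔ oA ⊔ ℓA) where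
    field
      preserves-cartesian : ∀ {x y} (f : Category._⇒_ X x y) →
                            IsCartesian p f → IsCartesian q (Functor.F₁ G f)
      commutes : (q ∘F G) ≃F p

module _ {oA ℓA oB ℓB oE ℓE} {A : Category oA ℓA} {B : Category oB ℓB} {E : Category oE ℓE} where

  record IsFibredCCU (r : Functor B A) (U : Functor E B)
         : Set (oA ⊔ ℓA ⊔ oB ⊔ ℓB ⊔ oE ⊔ ℓE) where
    field
      U-fibration : IsFibration U
      K : Functor B E
      K-truth : IsTruthFunctor U K
      Cmp : Functor E B
      adj : Adjunction K Cmp
      K-fibred : IsFibredFunctor r (r ∘F U) K
      Cmp-fibred : IsFibredFunctor (r ∘F U) r Cmp
      unit-vertical : ∀ X → IsVertical r (Adjunction.unit adj X)

  record IsFibredLawvere (r : Functor B A) (U : Functor E B)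
         : Set (oA ⊔ ℓA ⊔ oB ⊔ ℓB ⊔ oE ⊔ ℓE) where
    field
      ccu : IsFibredCCU r U
      U-opfibration : IsOpfibration U
    open IsFibredCCU ccu public

module FibreData {oA ℓA oB ℓB oE ℓE} {A : Category oA ℓA} {B : Category oB ℓB}
                 {E : Category oE ℓE} (r : Functor B A) (U : Functor E B)
                 (H : IsFibredLawvere r U) (a : Category.Obj A) where
  private
    module A = Category A
    module B = Category B
    module E = Category E
    module r = Functor r
    module U = Functor U
    module H = IsFibredLawvere H
    module K = Functor H.K
    module C = Functor H.Cmp
    module adj = Adjunction H.adj
    module BL = CatLemmas B
    module AL = CatLemmas A
    open FunctorLemmas
    over = IsTruthFunctor.over H.K-truth
    module over = _≃F_ over

  rU : Functor E A
  rU = r ∘F U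

  Ba : Category (oB ⊔ oA) (ℓB ⊔ ℓA)
  Ba = Fibre r a

  Ea : Category (oE ⊔ oA) (ℓE ⊔ ℓA)
  Ea = Fibre rU a

  private
    module Ba = Category Ba
    module Ea = Category Ea

  Ua : Functor Ea Ba
  Ua = restrict rU r U (≃F-refl rU) a

  Ka : Functor Ba Ea
  Ka = restrict r rU H.K (IsFibredFunctor.commutes H.K-fibred) a

  Cmpa : Functor Ea Ba
  Cmpa = restrict rU r H.Cmp (IsFibredFunctor.commutes H.Cmp-fibred) a

  private
    module Ua = Functor Ua
    module Ka = Functor Ka
    module Ca = Functor Cmpa

  counit-vertical : ∀ (P : E.Obj) → IsVertical rU (adj.counit P)
  counit-vertical P =
    ≃-path→ (IsFibredFunctor.commutes H.Cmp-fibred)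
      (AL.path-cancelʳ
        (AL.path-resp (trans (cong r.F₁ (sym (adj.zag P))) r.homomorphism)
          (AL.path-resp (sym r.identity) AL.path-id))
        (H.unit-vertical (C.F₀ P)))

  εa : ∀ (P : Ea.Obj) → Ka.F₀ (Ca.F₀ P) Ea.⇒ P
  εa P = fhom (adj.counit (proj₁ P))
         (fibre-fromPath rU {x = Ka.F₀ (Ca.F₀ P)} {P} _ (counit-vertical (proj₁ P)))

  -- π_P = U_a(ε_P) : {P}_a → U_a P   (with U_a K_a X identified with X)
  πmor : ∀ (P : Ea.Obj) → Ca.F₀ P Ba.⇒ Ua.F₀ P
  πmor P = fhom (U.F₁ (adj.counit (proj₁ P)) B.∘ B.≡⇒ (sym (over.eq₀ (C.F₀ (proj₁ P)))))
           (fibre-fromPath r {x = Ca.F₀ P} {Ua.F₀ P} _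
             (AL.path-resp (sym r.homomorphism)
               (AL.path-∘ (counit-vertical (proj₁ P))
                 (path-F r (BL.path-≡⇒ (sym (over.eq₀ (C.F₀ (proj₁ P)))))))))

  private
    UK≡⇒ : ∀ {X Y} (g : X B.⇒ Y) →
           U.F₁ (K.F₁ g) B.∘ B.≡⇒ (sym (over.eq₀ X)) ≡ B.≡⇒ (sym (over.eq₀ Y)) B.∘ g
    UK≡⇒ {X} {Y} g = BL.≡⇒-conj (over.eq₀ X) (over.eq₀ Y) (U.F₁ (K.F₁ g)) g (over.eq₁ g)

    π-natural₀ : ∀ {P Q : E.Obj} (h : P E.⇒ Q) →
                 U.F₁ h B.∘ (U.F₁ (adj.counit P) B.∘ B.≡⇒ (sym (over.eq₀ (C.F₀ P))))
                   ≡ (U.F₁ (adj.counit Q) B.∘ B.≡⇒ (sym (over.eq₀ (C.F₀ Q)))) B.∘ C.F₁ h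
    π-natural₀ {P} {Q} h = begin
        U.F₁ h B.∘ (U.F₁ εP B.∘ B.≡⇒ sP)
      ≡⟨ sym B.assoc ⟩
        (U.F₁ h B.∘ U.F₁ εP) B.∘ B.≡⇒ sP
      ≡⟨ cong (B._∘ B.≡⇒ sP) (sym U.homomorphism) ⟩
        U.F₁ (h E.∘ εP) B.∘ B.≡⇒ sP
      ≡⟨ cong (λ k → U.F₁ k B.∘ B.≡⇒ sP) (sym (adj.counit-natural h)) ⟩
        U.F₁ (εQ E.∘ K.F₁ (C.F₁ h)) B.∘ B.≡⇒ sP
      ≡⟨ cong (B._∘ B.≡⇒ sP) U.homomorphism ⟩
        (U.F₁ εQ B.∘ U.F₁ (K.F₁ (C.F₁ h))) B.∘ B.≡⇒ sP
      ≡⟨ B.assoc ⟩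
        U.F₁ εQ B.∘ (U.F₁ (K.F₁ (C.F₁ h)) B.∘ B.≡⇒ sP)
      ≡⟨ cong (U.F₁ εQ B.∘_) (UK≡⇒ (C.F₁ h)) ⟩
        U.F₁ εQ B.∘ (B.≡⇒ sQ B.∘ C.F₁ h)
      ≡⟨ sym B.assoc ⟩
        (U.F₁ εQ B.∘ B.≡⇒ sQ) B.∘ C.F₁ h
      ∎
      where
      open ≡-Reasoning
      εP = adj.counit P
      εQ = adj.counit Q
      sP = sym (over.eq₀ (C.F₀ P))
      sQ = sym (over.eq₀ (C.F₀ Q))

    π-natural : ∀ {P Q : Ea.Obj} (h : P Ea.⇒ Q) →
                Ua.F₁ h Ba.∘ πmor P ≡ πmor Q Ba.∘ Ca.F₁ h
    π-natural {P} {Q} h = fibre-ext r {x = Ca.F₀ P} {Ua.F₀ Q} (π-natural₀ (FibreHom.mor h))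

  πa : Functor Ea (Arr Ba)
  πa = record
    { F₀ = λ P → Ca.F₀ P , Ua.F₀ P , πmor P
    ; F₁ = λ h → square (Ca.F₁ h) (Ua.F₁ h) (π-natural h)
    ; identity = Arr-ext Ba Ca.identity Ua.identity
    ; homomorphism = Arr-ext Ba Ca.homomorphism Ua.homomorphism
    }

  -- I_a (f : X → Y) = Σ_f K_a X, using the cocartesian lifts of U
  private
    module Lift (o : Category.Obj (Arr Ba)) where
      X₀ = proj₁ (proj₁ o)
      Y₀ = proj₁ (proj₁ (proj₂ o))
      eY = proj₂ (proj₁ (proj₂ o))
      f₀ = FibreHom.mor (proj₂ (proj₂ o))
      ux = B.≡⇒ (over.eq₀ X₀)
      u = f₀ B.∘ ux
      L = H.U-opfibration (K.F₀ X₀) u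
      W = proj₁ L
      c = proj₁ (proj₂ L)
      cocart = proj₁ (proj₂ (proj₂ L))
      eW = proj₁ (proj₂ (proj₂ (proj₂ L)))
      ov = proj₂ (proj₂ (proj₂ (proj₂ L)))
      Uc : U.F₁ c ≡ B.≡⇒ (sym eW) B.∘ u
      Uc = BL.≡⇒-cancel eW _ _ ov
      obj : Ea.Obj
      obj = W , trans (cong r.F₀ eW) eY

    Iobj : Category.Obj (Arr Ba) → Ea.Obj
    Iobj = Lift.obj

    wmap : ∀ {o o'} → Category._⇒_ (Arr Ba) o o' → U.F₀ (Lift.W o) B.⇒ U.F₀ (Lift.W o')
    wmap {o} {o'} (square s t q) = B.≡⇒ (sym (Lift.eW o')) B.∘ (FibreHom.mor t B.∘ B.≡⇒ (Lift.eW o))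

    wcond : ∀ {o o'} (m : Category._⇒_ (Arr Ba) o o') →
            wmap m B.∘ U.F₁ (Lift.c o) ≡ U.F₁ (Lift.c o' E.∘ K.F₁ (FibreHom.mor (ArrHom.dom m)))
    wcond {o} {o'} (square s t q) = begin
        (B.≡⇒ s' B.∘ (t₀ B.∘ B.≡⇒ e)) B.∘ U.F₁ c
      ≡⟨ B.assoc ⟩
        B.≡⇒ s' B.∘ ((t₀ B.∘ B.≡⇒ e) B.∘ U.F₁ c)
      ≡⟨ cong (B.≡⇒ s' B.∘_) B.assoc ⟩
        B.≡⇒ s' B.∘ (t₀ B.∘ (B.≡⇒ e B.∘ U.F₁ c))
      ≡⟨ cong (λ k → B.≡⇒ s' B.∘ (t₀ B.∘ k)) (Lift.ov o) ⟩
        B.≡⇒ s' B.∘ (t₀ B.∘ (Lift.f₀ o B.∘ Lift.ux o))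
      ≡⟨ cong (B.≡⇒ s' B.∘_) (sym B.assoc) ⟩
        B.≡⇒ s' B.∘ ((t₀ B.∘ Lift.f₀ o) B.∘ Lift.ux o)
      ≡⟨ cong (λ k → B.≡⇒ s' B.∘ (k B.∘ Lift.ux o)) (cong FibreHom.mor q) ⟩
        B.≡⇒ s' B.∘ ((Lift.f₀ o' B.∘ s₀) B.∘ Lift.ux o)
      ≡⟨ cong (B.≡⇒ s' B.∘_) B.assoc ⟩
        B.≡⇒ s' B.∘ (Lift.f₀ o' B.∘ (s₀ B.∘ Lift.ux o))
      ≡⟨ cong (λ k → B.≡⇒ s' B.∘ (Lift.f₀ o' B.∘ k)) (sym (over.eq₁ s₀)) ⟩
        B.≡⇒ s' B.∘ (Lift.f₀ o' B.∘ (Lift.ux o' B.∘ U.F₁ (K.F₁ s₀)))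
      ≡⟨ cong (B.≡⇒ s' B.∘_) (sym B.assoc) ⟩
        B.≡⇒ s' B.∘ (Lift.u o' B.∘ U.F₁ (K.F₁ s₀))
      ≡⟨ sym B.assoc ⟩
        (B.≡⇒ s' B.∘ Lift.u o') B.∘ U.F₁ (K.F₁ s₀)
      ≡⟨ cong (B._∘ U.F₁ (K.F₁ s₀)) (sym (Lift.Uc o')) ⟩
        U.F₁ (Lift.c o') B.∘ U.F₁ (K.F₁ s₀)
      ≡⟨ sym U.homomorphism ⟩
        U.F₁ (Lift.c o' E.∘ K.F₁ s₀)
      ∎
      where
      open ≡-Reasoning
      s' = sym (Lift.eW o')
      e = Lift.eW o
      t₀ = FibreHom.mor t
      s₀ = FibreHom.mor s
      c = Lift.c o

    Imor₀ : ∀ {o o'} → Category._⇒_ (Arr Ba) o o' → Lift.W o E.⇒ Lift.W o'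
    Imor₀ {o} {o'} m = proj₁ (Lift.cocart o (Lift.c o' E.∘ K.F₁ (FibreHom.mor (ArrHom.dom m))) (wmap m) (wcond m))

    Imor-spec : ∀ {o o'} (m : Category._⇒_ (Arr Ba) o o') →
                (U.F₁ (Imor₀ m) ≡ wmap m × Imor₀ m E.∘ Lift.c o ≡ Lift.c o' E.∘ K.F₁ (FibreHom.mor (ArrHom.dom m)))
                × (∀ h' → U.F₁ h' ≡ wmap m → h' E.∘ Lift.c o ≡ Lift.c o' E.∘ K.F₁ (FibreHom.mor (ArrHom.dom m)) →
                          h' ≡ Imor₀ m)
    Imor-spec {o} {o'} m = proj₂ (Lift.cocart o (Lift.c o' E.∘ K.F₁ (FibreHom.mor (ArrHom.dom m))) (wmap m) (wcond m))

    wmap-path : ∀ {o o'} (m : Category._⇒_ (Arr Ba) o o') → A.IsPath (r.F₁ (wmap m))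
    wmap-path {o} {o'} (square s t q) =
      AL.path-resp (sym (trans r.homomorphism (cong (r.F₁ (B.≡⇒ (sym (Lift.eW o'))) A.∘_) r.homomorphism)))
        (AL.path-∘ (path-F r (BL.path-≡⇒ (sym (Lift.eW o'))))
          (AL.path-∘ (fibre-toPath r {x = proj₁ (proj₂ o)} {proj₁ (proj₂ o')} t)
                     (path-F r (BL.path-≡⇒ (Lift.eW o)))))

    Imor : ∀ {o o'} → Category._⇒_ (Arr Ba) o o' → Iobj o Ea.⇒ Iobj o'
    Imor {o} {o'} m = fhom (Imor₀ m)
      (fibre-fromPath rU {x = Iobj o} {Iobj o'} _
        (AL.path-resp (cong r.F₁ (sym (proj₁ (proj₁ (Imor-spec m))))) (wmap-path m)))

    I-identity : ∀ {o} → Imor (Category.id (Arr Ba) {o}) ≡ Ea.id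
    I-identity {o} = fibre-ext rU {x = Iobj o} {Iobj o} (sym
      (proj₂ (Imor-spec (Category.id (Arr Ba) {o})) E.id
        (BL.path-unique (BL.path-resp (sym U.identity) BL.path-id)
          (BL.path-∘ (BL.path-≡⇒ (sym (Lift.eW o))) (BL.path-∘ BL.path-id (BL.path-≡⇒ (Lift.eW o)))))
        (trans E.identityˡ (sym (trans (cong (Lift.c o E.∘_) K.identity) E.identityʳ)))))

    I-homomorphism : ∀ {o o' o''} {m : Category._⇒_ (Arr Ba) o o'}
                       {m' : Category._⇒_ (Arr Ba) o' o''} →
                     Imor (Category._∘_ (Arr Ba) m' m) ≡ Imor m' Ea.∘ Imor m
    I-homomorphism {o} {o'} {o''} {m} {m'} = fibre-ext rU {x = Iobj o} {Iobj o''} (sym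
      (proj₂ (Imor-spec (Category._∘_ (Arr Ba) m' m)) (Imor₀ m' E.∘ Imor₀ m)
        (trans U.homomorphism
          (trans (cong₂ B._∘_ (proj₁ (proj₁ (Imor-spec m'))) (proj₁ (proj₁ (Imor-spec m))))
            (BL.≡⇒-sandwich (Lift.eW o) (Lift.eW o') (Lift.eW o'')
              (FibreHom.mor (ArrHom.cod m)) (FibreHom.mor (ArrHom.cod m')))))
        (begin
            (Imor₀ m' E.∘ Imor₀ m) E.∘ Lift.c o
          ≡⟨ E.assoc ⟩
            Imor₀ m' E.∘ (Imor₀ m E.∘ Lift.c o)
          ≡⟨ cong (Imor₀ m' E.∘_) (proj₂ (proj₁ (Imor-spec m))) ⟩
            Imor₀ m' E.∘ (Lift.c o' E.∘ K.F₁ s₀)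
          ≡⟨ sym E.assoc ⟩
            (Imor₀ m' E.∘ Lift.c o') E.∘ K.F₁ s₀
          ≡⟨ cong (E._∘ K.F₁ s₀) (proj₂ (proj₁ (Imor-spec m'))) ⟩
            (Lift.c o'' E.∘ K.F₁ s₀') E.∘ K.F₁ s₀
          ≡⟨ E.assoc ⟩
            Lift.c o'' E.∘ (K.F₁ s₀' E.∘ K.F₁ s₀)
          ≡⟨ cong (Lift.c o'' E.∘_) (sym K.homomorphism) ⟩
            Lift.c o'' E.∘ K.F₁ (s₀' B.∘ s₀)
          ∎)))
      where
      open ≡-Reasoning
      s₀ = FibreHom.mor (ArrHom.dom m)
      s₀' = FibreHom.mor (ArrHom.dom m')

  Ia : Functor (Arr Ba) Ea
  Ia = record
    { F₀ = Iobj
    ; F₁ = Imor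
    ; identity = I-identity
    ; homomorphism = λ {_} {_} {_} {m} {m'} → I-homomorphism {m = m} {m'}
    }

  canonicalLifting : Functor Ba Ba → Functor Ea Ea
  canonicalLifting F = Ia ∘F (Arrow F ∘F πa)

  record KaPreservingLifting (F : Functor Ba Ba) (G : Functor Ea Ea)
         : Set (oA ⊔ ℓA ⊔ oB ⊔ ℓB ⊔ oE ⊔ ℓE) where
    field
      lifts : (Ua ∘F G) ≃F (F ∘F Ua)
      iso : NatIso (G ∘F Ka) (Ka ∘F F)

  -- the functor  (α : F X → X) ↦ (F̂ K_a X ≅ K_a F X → K_a X)  preserves
  -- initial objects
  SoundInductionRule : (F : Functor Ba Ba) (G : Functor Ea Ea) →
                       KaPreservingLifting F G → Set (oA ⊔ ℓA ⊔ oB ⊔ ℓB ⊔ oE ⊔ ℓE)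
  SoundInductionRule F G L =
    ∀ (X : Ba.Obj) (α : Functor.F₀ F X Ba.⇒ X) → IsInitialAlgebra Ba F X α →
      IsInitialAlgebra Ea G (Ka.F₀ X)
        (Ka.F₁ α Ea.∘ NatIso.η (KaPreservingLifting.iso L) X)

module Submission where

-- K_a is left adjoint to {-}_a, and a K_a-preserving lifting F̂ comes with F̂ K_a ≅ K_a F. Transposing
-- along the adjunction turns F̂-algebra maps out of K_a X into F-algebra maps into {Y}_a, so K_a carries
-- initial F-algebras to initial F̂-algebras. For F̂ P = Σ_{F π_P} K_a F {P}_a one checks that F̂ K_a ≅ K_a F:
-- in a comprehension category with unit, π_{K_a X} is inverse to the unit X → {K_a X}, so opreindexing
-- K_a F {K_a X}_a along the isomorphism F π_{K_a X} gives back K_a F X. The comparison map is the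
-- transpose of F applied to U_a K_a X = X along U_a ⊣ K_a (maps into a truth object are determined by
-- their image under U), and its inverse is the cocartesian lift composed with K_a F of the unit.

open import Defs
open import Data.Product using (Σ; _×_; Σ-syntax)
open import Relation.Binary.PropositionalEquality
open import Data.Product using (_,_; proj₁; proj₂)

module CategoryProperties {o ℓ} (C : Category o ℓ) where
  open Category C

  precomp-section : ∀ {X Y Z} {i : X ⇒ Y} {j : Y ⇒ X} {f : X ⇒ Z} {g : Y ⇒ Z} →
                    j ∘ i ≡ id → g ≡ f ∘ j → g ∘ i ≡ f
  precomp-section {i = i} {j} {f} {g} ji≡id g≡fj = begin
      g ∘ i        ≡⟨ cong (_∘ i) g≡fj ⟩
      (f ∘ j) ∘ i  ≡⟨ assoc ⟩
      f ∘ (j ∘ i)  ≡⟨ cong (f ∘_) ji≡id ⟩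
      f ∘ id       ≡⟨ identityʳ ⟩
      f            ∎
    where open ≡-Reasoning

  cancel-sectionˡ : ∀ {X Y Z} {i : X ⇒ Y} {j : Y ⇒ X} (f : Z ⇒ X) → j ∘ i ≡ id → j ∘ (i ∘ f) ≡ f
  cancel-sectionˡ f ji≡id = trans (sym assoc) (trans (cong (_∘ f) ji≡id) identityˡ)

  ≡⇒-cancelˡ : ∀ {W X Y} (p : X ≡ Y) {f g : W ⇒ X} → ≡⇒ p ∘ f ≡ ≡⇒ p ∘ g → f ≡ g
  ≡⇒-cancelˡ refl e = trans (sym identityˡ) (trans e identityˡ)

  ≡⇒-cancelʳ : ∀ {X Y Z} (p : X ≡ Y) {f g : Y ⇒ Z} → f ∘ ≡⇒ p ≡ g ∘ ≡⇒ p → f ≡ g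
  ≡⇒-cancelʳ refl e = trans (sym identityʳ) (trans e identityʳ)

  ≡⇒-sym-cancel : ∀ {W X Y Z} (p : X ≡ Y) (f : Y ⇒ Z) (g : W ⇒ Y) → (f ∘ ≡⇒ p) ∘ (≡⇒ (sym p) ∘ g) ≡ f ∘ g
  ≡⇒-sym-cancel refl f g = cong₂ _∘_ identityʳ identityˡ

module FunctorProperties {oC ℓC oD ℓD} {C : Category oC ℓC} {D : Category oD ℓD} (F : Functor C D) where
  private
    module C = Category C
    module D = Category D
  open Functor F

  F-resp-square : ∀ {W X Y Z} {f : W C.⇒ X} {g : X C.⇒ Z} {k : W C.⇒ Y} {h : Y C.⇒ Z} →
                  g C.∘ f ≡ h C.∘ k → F₁ g D.∘ F₁ f ≡ F₁ h D.∘ F₁ k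
  F-resp-square e = trans (sym homomorphism) (trans (cong F₁ e) homomorphism)

  F-resp-inverse : ∀ {X Y} {f : X C.⇒ Y} {g : Y C.⇒ X} → g C.∘ f ≡ C.id → F₁ g D.∘ F₁ f ≡ D.id
  F-resp-inverse e = trans (sym homomorphism) (trans (cong F₁ e) identity)

module NatIsoProperties {oC ℓC oD ℓD} {C : Category oC ℓC} {D : Category oD ℓD}
                        {F G : Functor C D} (θ : NatIso F G) where
  private
    module C = Category C
    module D = Category D
    module F = Functor F
    module G = Functor G
  open NatIso θ
  open CategoryProperties D

  η⁻¹-commute : ∀ {X Y} (f : X C.⇒ Y) → η⁻¹ Y D.∘ G.F₁ f ≡ F.F₁ f D.∘ η⁻¹ X
  η⁻¹-commute {X} {Y} f = begin
      η⁻¹ Y D.∘ G.F₁ f                         ≡⟨ sym (precomp-section (isoʳ X) refl) ⟩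
      ((η⁻¹ Y D.∘ G.F₁ f) D.∘ η X) D.∘ η⁻¹ X   ≡⟨ cong (D._∘ η⁻¹ X) D.assoc ⟩
      (η⁻¹ Y D.∘ (G.F₁ f D.∘ η X)) D.∘ η⁻¹ X   ≡⟨ cong (λ k → (η⁻¹ Y D.∘ k) D.∘ η⁻¹ X) (sym (commute f)) ⟩
      (η⁻¹ Y D.∘ (η Y D.∘ F.F₁ f)) D.∘ η⁻¹ X   ≡⟨ cong (D._∘ η⁻¹ X) (cancel-sectionˡ (F.F₁ f) (isoˡ Y)) ⟩
      F.F₁ f D.∘ η⁻¹ X                         ∎
    where open ≡-Reasoning

module AdjunctionProperties {oC ℓC oD ℓD} {C : Category oC ℓC} {D : Category oD ℓD}
                            {L : Functor C D} {R : Functor D C} (adj : Adjunction L R) where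
  private
    module C = Category C
    module D = Category D
    module L = Functor L
    module R = Functor R
  open Adjunction adj
  open ≡-Reasoning

  Ladjunct : ∀ {X Y} → L.F₀ X D.⇒ Y → X C.⇒ R.F₀ Y
  Ladjunct {X} f = R.F₁ f C.∘ unit X

  Radjunct : ∀ {X Y} → X C.⇒ R.F₀ Y → L.F₀ X D.⇒ Y
  Radjunct {Y = Y} g = counit Y D.∘ L.F₁ g

  Radjunct-Ladjunct : ∀ {X Y} (f : L.F₀ X D.⇒ Y) → Radjunct (Ladjunct f) ≡ f
  Radjunct-Ladjunct {X} {Y} f = begin
      counit Y D.∘ L.F₁ (R.F₁ f C.∘ unit X)                     ≡⟨ cong (counit Y D.∘_) L.homomorphism ⟩
      counit Y D.∘ (L.F₁ (R.F₁ f) D.∘ L.F₁ (unit X))            ≡⟨ sym D.assoc ⟩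
      (counit Y D.∘ L.F₁ (R.F₁ f)) D.∘ L.F₁ (unit X)            ≡⟨ cong (D._∘ L.F₁ (unit X)) (counit-natural f) ⟩
      (f D.∘ counit (L.F₀ X)) D.∘ L.F₁ (unit X)                 ≡⟨ D.assoc ⟩
      f D.∘ (counit (L.F₀ X) D.∘ L.F₁ (unit X))                 ≡⟨ cong (f D.∘_) (zig X) ⟩
      f D.∘ D.id                                                ≡⟨ D.identityʳ ⟩
      f                                                         ∎

  Ladjunct-Radjunct : ∀ {X Y} (g : X C.⇒ R.F₀ Y) → Ladjunct (Radjunct g) ≡ g
  Ladjunct-Radjunct {X} {Y} g = begin
      R.F₁ (counit Y D.∘ L.F₁ g) C.∘ unit X                     ≡⟨ cong (C._∘ unit X) R.homomorphism ⟩
      (R.F₁ (counit Y) C.∘ R.F₁ (L.F₁ g)) C.∘ unit X            ≡⟨ C.assoc ⟩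
      R.F₁ (counit Y) C.∘ (R.F₁ (L.F₁ g) C.∘ unit X)            ≡⟨ cong (R.F₁ (counit Y) C.∘_) (sym (unit-natural g)) ⟩
      R.F₁ (counit Y) C.∘ (unit (R.F₀ Y) C.∘ g)                 ≡⟨ sym C.assoc ⟩
      (R.F₁ (counit Y) C.∘ unit (R.F₀ Y)) C.∘ g                 ≡⟨ cong (C._∘ g) (zag Y) ⟩
      C.id C.∘ g                                                ≡⟨ C.identityˡ ⟩
      g                                                         ∎

  Radjunct-injective : ∀ {X Y} {g g' : X C.⇒ R.F₀ Y} → Radjunct g ≡ Radjunct g' → g ≡ g'
  Radjunct-injective {g = g} {g'} e =
    trans (sym (Ladjunct-Radjunct g)) (trans (cong Ladjunct e) (Ladjunct-Radjunct g'))

  Radjunct-∘ : ∀ {W X Y} (g : X C.⇒ R.F₀ Y) (h : W C.⇒ X) → Radjunct (g C.∘ h) ≡ Radjunct g D.∘ L.F₁ h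
  Radjunct-∘ {Y = Y} g h = begin
      counit Y D.∘ L.F₁ (g C.∘ h)              ≡⟨ cong (counit Y D.∘_) L.homomorphism ⟩
      counit Y D.∘ (L.F₁ g D.∘ L.F₁ h)         ≡⟨ sym D.assoc ⟩
      (counit Y D.∘ L.F₁ g) D.∘ L.F₁ h         ∎

-- For L ⊣ R and θ : G L ≅ L F, the G-algebra maps (L X, L α ∘ θ) → (Y, β) are the
-- transposes of the F-algebra maps (X, α) → (R Y, Ladjunct (β ∘ G ε ∘ θ⁻¹)).
module LiftedInitialAlgebra {oC ℓC oD ℓD} {C : Category oC ℓC} {D : Category oD ℓD}
                            {L : Functor C D} {R : Functor D C} (adj : Adjunction L R)
                            (F : Functor C C) (G : Functor D D) (θ : NatIso (G ∘F L) (L ∘F F)) where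
  private
    module C = Category C
    module D = Category D
    module L = Functor L
    module R = Functor R
    module F = Functor F
    module G = Functor G
    module θ = NatIso θ
  open Adjunction adj using (counit)
  open AdjunctionProperties adj
  open NatIsoProperties θ
  open CategoryProperties D
  open ≡-Reasoning

  transposeAlgebra : ∀ {Y} → G.F₀ Y D.⇒ Y → F.F₀ (R.F₀ Y) C.⇒ R.F₀ Y
  transposeAlgebra {Y} β = Ladjunct (β D.∘ (G.F₁ (counit Y) D.∘ θ.η⁻¹ (R.F₀ Y)))

  Radjunct-transposeAlgebra : ∀ {X Y} (β : G.F₀ Y D.⇒ Y) (g : X C.⇒ R.F₀ Y) →
    Radjunct (transposeAlgebra β C.∘ F.F₁ g) ≡ (β D.∘ G.F₁ (Radjunct g)) D.∘ θ.η⁻¹ X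
  Radjunct-transposeAlgebra {X} {Y} β g = begin
      Radjunct (transposeAlgebra β C.∘ F.F₁ g)
    ≡⟨ Radjunct-∘ _ _ ⟩
      Radjunct (transposeAlgebra β) D.∘ L.F₁ (F.F₁ g)
    ≡⟨ cong (D._∘ L.F₁ (F.F₁ g)) (Radjunct-Ladjunct _) ⟩
      (β D.∘ (G.F₁ ε D.∘ θ.η⁻¹ (R.F₀ Y))) D.∘ L.F₁ (F.F₁ g)
    ≡⟨ D.assoc ⟩
      β D.∘ ((G.F₁ ε D.∘ θ.η⁻¹ (R.F₀ Y)) D.∘ L.F₁ (F.F₁ g))
    ≡⟨ cong (β D.∘_) D.assoc ⟩
      β D.∘ (G.F₁ ε D.∘ (θ.η⁻¹ (R.F₀ Y) D.∘ L.F₁ (F.F₁ g)))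
    ≡⟨ cong (λ k → β D.∘ (G.F₁ ε D.∘ k)) (η⁻¹-commute g) ⟩
      β D.∘ (G.F₁ ε D.∘ (G.F₁ (L.F₁ g) D.∘ θ.η⁻¹ X))
    ≡⟨ cong (β D.∘_) (sym D.assoc) ⟩
      β D.∘ ((G.F₁ ε D.∘ G.F₁ (L.F₁ g)) D.∘ θ.η⁻¹ X)
    ≡⟨ cong (λ k → β D.∘ (k D.∘ θ.η⁻¹ X)) (sym G.homomorphism) ⟩
      β D.∘ (G.F₁ (Radjunct g) D.∘ θ.η⁻¹ X)
    ≡⟨ sym D.assoc ⟩
      (β D.∘ G.F₁ (Radjunct g)) D.∘ θ.η⁻¹ X
    ∎
    where ε = counit Y

  Radjunct-preserves-algebra-maps : ∀ {X Y} (α : F.F₀ X C.⇒ X) (β : G.F₀ Y D.⇒ Y) (g : X C.⇒ R.F₀ Y) →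
    g C.∘ α ≡ transposeAlgebra β C.∘ F.F₁ g →
    Radjunct g D.∘ (L.F₁ α D.∘ θ.η X) ≡ β D.∘ G.F₁ (Radjunct g)
  Radjunct-preserves-algebra-maps {X} α β g e = begin
      Radjunct g D.∘ (L.F₁ α D.∘ θ.η X)     ≡⟨ sym D.assoc ⟩
      (Radjunct g D.∘ L.F₁ α) D.∘ θ.η X     ≡⟨ precomp-section (θ.isoˡ X) (begin
        Radjunct g D.∘ L.F₁ α                   ≡⟨ sym (Radjunct-∘ g α) ⟩
        Radjunct (g C.∘ α)                      ≡⟨ cong Radjunct e ⟩
        Radjunct (transposeAlgebra β C.∘ F.F₁ g) ≡⟨ Radjunct-transposeAlgebra β g ⟩
        (β D.∘ G.F₁ (Radjunct g)) D.∘ θ.η⁻¹ X   ∎) ⟩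
      β D.∘ G.F₁ (Radjunct g)               ∎

  Radjunct-reflects-algebra-maps : ∀ {X Y} (α : F.F₀ X C.⇒ X) (β : G.F₀ Y D.⇒ Y) (g : X C.⇒ R.F₀ Y) →
    Radjunct g D.∘ (L.F₁ α D.∘ θ.η X) ≡ β D.∘ G.F₁ (Radjunct g) →
    g C.∘ α ≡ transposeAlgebra β C.∘ F.F₁ g
  Radjunct-reflects-algebra-maps {X} α β g e = Radjunct-injective (begin
      Radjunct (g C.∘ α)                        ≡⟨ Radjunct-∘ g α ⟩
      Radjunct g D.∘ L.F₁ α                     ≡⟨ sym (precomp-section (θ.isoʳ X) (trans (sym e) (sym D.assoc))) ⟩
      (β D.∘ G.F₁ (Radjunct g)) D.∘ θ.η⁻¹ X     ≡⟨ sym (Radjunct-transposeAlgebra β g) ⟩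
      Radjunct (transposeAlgebra β C.∘ F.F₁ g)  ∎)

  left-adjoint-preserves-initial-algebras : ∀ {X} (α : F.F₀ X C.⇒ X) →
    IsInitialAlgebra C F X α → IsInitialAlgebra D G (L.F₀ X) (L.F₁ α D.∘ θ.η X)
  left-adjoint-preserves-initial-algebras α initial Y β =
    Radjunct h , Radjunct-preserves-algebra-maps α β h h-algebra-map , unique
    where
    h = proj₁ (initial (R.F₀ Y) (transposeAlgebra β))
    h-algebra-map = proj₁ (proj₂ (initial (R.F₀ Y) (transposeAlgebra β)))
    h-unique = proj₂ (proj₂ (initial (R.F₀ Y) (transposeAlgebra β)))

    unique : ∀ k → k D.∘ (L.F₁ α D.∘ θ.η _) ≡ β D.∘ G.F₁ k → k ≡ Radjunct h
    unique k k-algebra-map = begin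
        k                      ≡⟨ sym (Radjunct-Ladjunct k) ⟩
        Radjunct (Ladjunct k)  ≡⟨ cong Radjunct (h-unique (Ladjunct k)
                                    (Radjunct-reflects-algebra-maps α β (Ladjunct k)
                                      (subst (λ k' → k' D.∘ (L.F₁ α D.∘ θ.η _) ≡ β D.∘ G.F₁ k')
                                             (sym (Radjunct-Ladjunct k)) k-algebra-map))) ⟩
        Radjunct h             ∎

module FibreProperties {oE ℓE oB ℓB} {E : Category oE ℓE} {B : Category oB ℓB} (P : Functor E B) where
  private
    module E = Category E
    module B = Category B
    module P = Functor P
    module BL = CatLemmas B

  FibreObj-≡ : ∀ {I} {x y : FibreObj P I} → proj₁ x ≡ proj₁ y → x ≡ y
  FibreObj-≡ {x = X , p} {.X , q} refl = cong (X ,_) (uip p q)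

  mor-≡⇒ : ∀ {I} {x y : FibreObj P I} (e : proj₁ x ≡ proj₁ y) →
           FibreHom.mor (Category.≡⇒ (Fibre P I) (FibreObj-≡ {x = x} {y} e)) ≡ E.≡⇒ e
  mor-≡⇒ {x = X , p} {.X , q} refl with uip p q
  ... | refl = refl

  toFibreHom : ∀ {I} {x y : FibreObj P I} (f : proj₁ x E.⇒ proj₁ y) → IsVertical P f → FibreHom P x y
  toFibreHom {x = x} {y} f v = fhom f (fibre-fromPath P {x = x} {y} f v)

  vertical-≡⇒ : ∀ {X Y} (p : X ≡ Y) → IsVertical P (E.≡⇒ p)
  vertical-≡⇒ p = FunctorLemmas.path-F P (CatLemmas.path-≡⇒ E p)

  vertical-cancelˡ : ∀ {X Y Z} {g : Y E.⇒ Z} {f : X E.⇒ Y} → IsVertical P (g E.∘ f) → IsVertical P g → IsVertical P f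
  vertical-cancelˡ vgf vg = BL.path-cancelˡ (BL.path-resp P.homomorphism vgf) vg

  vertical-∘ : ∀ {X Y Z} {g : Y E.⇒ Z} {f : X E.⇒ Y} → IsVertical P g → IsVertical P f → IsVertical P (g E.∘ f)
  vertical-∘ vg vf = BL.path-resp (sym P.homomorphism) (BL.path-∘ vg vf)

  cocartesian-unique : ∀ {Y Z W} {c : Y E.⇒ Z} → IsCocartesian P c → {h h' : Z E.⇒ W} →
                       P.F₁ h ≡ P.F₁ h' → h E.∘ c ≡ h' E.∘ c → h ≡ h'
  cocartesian-unique {c = c} cocart {h} {h'} Ph≡Ph' hc≡h'c =
    trans (unique h refl refl) (sym (unique h' (sym Ph≡Ph') (sym hc≡h'c)))
    where unique = proj₂ (proj₂ (cocart (h E.∘ c) (P.F₁ h) (sym P.homomorphism)))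

module TruthFunctorProperties {oE ℓE oB ℓB} {E : Category oE ℓE} {B : Category oB ℓB}
                              {U : Functor E B} {K : Functor B E}
                              (fibration : IsFibration U) (truth : IsTruthFunctor U K) where
  private
    module E = Category E
    module B = Category B
    module U = Functor U
    module K = Functor K
    module BL = CatLemmas B
    module over = _≃F_ (IsTruthFunctor.over truth)

  -- The cartesian lift of U g into K Z has a terminal domain (stability), and g, g' both factor through it.
  truth-maps-unique : ∀ {Q Z} {g g' : Q E.⇒ K.F₀ Z} → U.F₁ g ≡ U.F₁ g' → g ≡ g'
  truth-maps-unique {Q} {Z} {g} {g'} Ug≡Ug' = begin
      g        ≡⟨ sym (proj₂ (proj₁ (proj₂ factor-g))) ⟩
      f E.∘ h  ≡⟨ cong (λ k → f E.∘ FibreHom.mor k)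
                    (trans (unique (asFibreHom h Uh)) (sym (unique (asFibreHom h' Uh')))) ⟩
      f E.∘ h' ≡⟨ proj₂ (proj₁ (proj₂ factor-g')) ⟩
      g'       ∎
    where
    open ≡-Reasoning
    lift = fibration (K.F₀ Z) (U.F₁ g)
    Y = proj₁ lift
    f = proj₁ (proj₂ lift)
    f-cartesian = proj₁ (proj₂ (proj₂ lift))
    e = proj₁ (proj₂ (proj₂ (proj₂ lift)))
    f-over : U.F₁ f B.∘ B.≡⇒ (sym e) ≡ U.F₁ g
    f-over = begin
        U.F₁ f B.∘ B.≡⇒ (sym e)                      ≡⟨ cong (B._∘ B.≡⇒ (sym e)) (proj₂ (proj₂ (proj₂ (proj₂ lift)))) ⟩
        (U.F₁ g B.∘ B.≡⇒ e) B.∘ B.≡⇒ (sym e)         ≡⟨ B.assoc ⟩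
        U.F₁ g B.∘ (B.≡⇒ e B.∘ B.≡⇒ (sym e))         ≡⟨ cong (U.F₁ g B.∘_) (BL.≡⇒-symʳ e) ⟩
        U.F₁ g B.∘ B.id                              ≡⟨ B.identityʳ ⟩
        U.F₁ g                                       ∎
    factor-g = f-cartesian g (B.≡⇒ (sym e)) f-over
    factor-g' = f-cartesian g' (B.≡⇒ (sym e)) (trans f-over Ug≡Ug')
    h = proj₁ factor-g
    h' = proj₁ factor-g'
    Uh = proj₁ (proj₁ (proj₂ factor-g))
    Uh' = proj₁ (proj₁ (proj₂ factor-g'))
    unique = proj₂ (IsTruthFunctor.stable truth f f-cartesian (Q , sym e))
    asFibreHom : (k : Q E.⇒ Y) → U.F₁ k ≡ B.≡⇒ (sym e) → FibreHom U (Q , sym e) (Y , refl)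
    asFibreHom k Uk = fhom k (trans B.identityˡ Uk)

  K-faithful : ∀ {Z Z'} {v v' : Z B.⇒ Z'} → K.F₁ v ≡ K.F₁ v' → v ≡ v'
  K-faithful {Z} {v = v} {v'} e = CategoryProperties.≡⇒-cancelʳ B (over.eq₀ Z)
    (trans (sym (over.eq₁ v)) (trans (cong (λ k → B.≡⇒ (over.eq₀ _) B.∘ U.F₁ k) e) (over.eq₁ v')))

  base : ∀ {Q Z} → Q E.⇒ K.F₀ Z → U.F₀ Q B.⇒ Z
  base {Z = Z} g = B.≡⇒ (over.eq₀ Z) B.∘ U.F₁ g

  base-injective : ∀ {Q Z} {g g' : Q E.⇒ K.F₀ Z} → base g ≡ base g' → g ≡ g'
  base-injective {Z = Z} e = truth-maps-unique (CategoryProperties.≡⇒-cancelˡ B (over.eq₀ Z) e)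

  base-∘ : ∀ {P Q Z} (g : Q E.⇒ K.F₀ Z) (k : P E.⇒ Q) → base (g E.∘ k) ≡ base g B.∘ U.F₁ k
  base-∘ {Z = Z} g k = trans (cong (B.≡⇒ (over.eq₀ Z) B.∘_) U.homomorphism) (sym B.assoc)

  base-K∘ : ∀ {Q Z Z'} (v : Z B.⇒ Z') (g : Q E.⇒ K.F₀ Z) → base (K.F₁ v E.∘ g) ≡ v B.∘ base g
  base-K∘ {Z = Z} {Z'} v g = begin
      base (K.F₁ v E.∘ g)                                    ≡⟨ base-∘ (K.F₁ v) g ⟩
      (B.≡⇒ (over.eq₀ Z') B.∘ U.F₁ (K.F₁ v)) B.∘ U.F₁ g      ≡⟨ cong (B._∘ U.F₁ g) (over.eq₁ v) ⟩
      (v B.∘ B.≡⇒ (over.eq₀ Z)) B.∘ U.F₁ g                   ≡⟨ B.assoc ⟩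
      v B.∘ base g                                           ∎
    where open ≡-Reasoning

  private
    terminal-map : ∀ Q → FibreHom U (Q , refl) (K.F₀ (U.F₀ Q) , over.eq₀ (U.F₀ Q))
    terminal-map Q = proj₁ (IsTruthFunctor.terminal truth (U.F₀ Q) (Q , refl))

  toTruth : ∀ {Q Z} → U.F₀ Q B.⇒ Z → Q E.⇒ K.F₀ Z
  toTruth {Q} u = K.F₁ u E.∘ FibreHom.mor (terminal-map Q)

  base-toTruth : ∀ {Q Z} (u : U.F₀ Q B.⇒ Z) → base (toTruth u) ≡ u
  base-toTruth {Q} u = trans (base-K∘ u _) (trans (cong (u B.∘_) (FibreHom.over-id (terminal-map Q))) B.identityʳ)

  toTruth-vertical : ∀ {oA ℓA} {A : Category oA ℓA} (V : Functor B A) {Q Z} (u : U.F₀ Q B.⇒ Z) →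
                     IsVertical V u → IsVertical V (U.F₁ (toTruth u))
  toTruth-vertical {A = A} V {Z = Z} u vu =
    FibreProperties.vertical-cancelˡ V (CatLemmas.path-resp A (cong (Functor.F₁ V) (sym (base-toTruth u))) vu)
      (FibreProperties.vertical-≡⇒ V (over.eq₀ Z))

module ComprehensionProperties {oE ℓE oB ℓB} {E : Category oE ℓE} {B : Category oB ℓB}
                               {U : Functor E B} {K : Functor B E} {Cmp : Functor E B}
                               (fibration : IsFibration U) (truth : IsTruthFunctor U K)
                               (adj : Adjunction K Cmp) where
  private
    module E = Category E
    module B = Category B
    module U = Functor U
    module K = Functor K
    module Cmp = Functor Cmp
    module BL = CatLemmas B
    module over = _≃F_ (IsTruthFunctor.over truth)
  open Adjunction adj
  open AdjunctionProperties adj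
  open TruthFunctorProperties fibration truth
  open ≡-Reasoning

  π : ∀ P → Cmp.F₀ P B.⇒ U.F₀ P
  π P = U.F₁ (counit P) B.∘ B.≡⇒ (sym (over.eq₀ (Cmp.F₀ P)))

  -- π_{K Z}, read through U K Z = Z
  πK : ∀ Z → Cmp.F₀ (K.F₀ Z) B.⇒ Z
  πK Z = B.≡⇒ (over.eq₀ Z) B.∘ π (K.F₀ Z)

  K-πK : ∀ Z → K.F₁ (πK Z) ≡ counit (K.F₀ Z)
  K-πK Z = base-injective (begin
      base (K.F₁ (πK Z))                                          ≡⟨ over.eq₁ (πK Z) ⟩
      πK Z B.∘ B.≡⇒ e'                                            ≡⟨ B.assoc ⟩
      B.≡⇒ (over.eq₀ Z) B.∘ (π (K.F₀ Z) B.∘ B.≡⇒ e')             ≡⟨ cong (B.≡⇒ (over.eq₀ Z) B.∘_) (begin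
          (U.F₁ (counit (K.F₀ Z)) B.∘ B.≡⇒ (sym e')) B.∘ B.≡⇒ e'     ≡⟨ B.assoc ⟩
          U.F₁ (counit (K.F₀ Z)) B.∘ (B.≡⇒ (sym e') B.∘ B.≡⇒ e')     ≡⟨ cong (U.F₁ (counit (K.F₀ Z)) B.∘_) (BL.≡⇒-symˡ e') ⟩
          U.F₁ (counit (K.F₀ Z)) B.∘ B.id                            ≡⟨ B.identityʳ ⟩
          U.F₁ (counit (K.F₀ Z))                                     ∎) ⟩
      base (counit (K.F₀ Z))                                      ∎)
    where e' = over.eq₀ (Cmp.F₀ (K.F₀ Z))

  πK-unit : ∀ Z → πK Z B.∘ unit Z ≡ B.id
  πK-unit Z = K-faithful (begin
      K.F₁ (πK Z B.∘ unit Z)                 ≡⟨ K.homomorphism ⟩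
      K.F₁ (πK Z) E.∘ K.F₁ (unit Z)          ≡⟨ cong (E._∘ K.F₁ (unit Z)) (K-πK Z) ⟩
      counit (K.F₀ Z) E.∘ K.F₁ (unit Z)      ≡⟨ zig Z ⟩
      E.id                                   ≡⟨ sym K.identity ⟩
      K.F₁ B.id                              ∎)

  unit-πK : ∀ Z → unit Z B.∘ πK Z ≡ B.id
  unit-πK Z = Radjunct-injective (begin
      Radjunct (unit Z B.∘ πK Z)                 ≡⟨ Radjunct-∘ (unit Z) (πK Z) ⟩
      Radjunct (unit Z) E.∘ K.F₁ (πK Z)          ≡⟨ cong₂ E._∘_ (zig Z) (K-πK Z) ⟩
      E.id E.∘ counit (K.F₀ Z)                   ≡⟨ E.identityˡ ⟩
      counit (K.F₀ Z)                            ≡⟨ sym E.identityʳ ⟩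
      counit (K.F₀ Z) E.∘ E.id                   ≡⟨ cong (counit (K.F₀ Z) E.∘_) (sym K.identity) ⟩
      Radjunct B.id                              ∎)

  π-unit : ∀ Z → π (K.F₀ Z) B.∘ (unit Z B.∘ B.≡⇒ (over.eq₀ Z)) ≡ B.id
  π-unit Z = CategoryProperties.≡⇒-cancelˡ B (over.eq₀ Z) (begin
      ρ B.∘ (π (K.F₀ Z) B.∘ (unit Z B.∘ ρ))      ≡⟨ cong (ρ B.∘_) (sym B.assoc) ⟩
      ρ B.∘ ((π (K.F₀ Z) B.∘ unit Z) B.∘ ρ)      ≡⟨ sym B.assoc ⟩
      (ρ B.∘ (π (K.F₀ Z) B.∘ unit Z)) B.∘ ρ      ≡⟨ cong (B._∘ ρ) (trans (sym B.assoc) (πK-unit Z)) ⟩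
      B.id B.∘ ρ                                  ≡⟨ B.identityˡ ⟩
      ρ                                           ≡⟨ sym B.identityʳ ⟩
      ρ B.∘ B.id                                  ∎)
    where ρ = B.≡⇒ (over.eq₀ Z)

module FibredLawvereProperties {oA ℓA oB ℓB oE ℓE} {A : Category oA ℓA} {B : Category oB ℓB}
                               {E : Category oE ℓE} (r : Functor B A) (U : Functor E B)
                               (H : IsFibredLawvere r U) (a : Category.Obj A) where
  open FibreData r U H a
  private
    module B = Category B
    module E = Category E
    module r = Functor r
    module U = Functor U
    module H = IsFibredLawvere H
    module K = Functor H.K
    module adj = Adjunction H.adj
    module BL = CatLemmas B
    module Ba = Category Ba
    module Ea = Category Ea
    module Ua = Functor Ua
    module Ka = Functor Ka
    module Ca = Functor Cmpa
    module Fr = FibreProperties r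
    module FrU = FibreProperties rU
    module over = _≃F_ (IsTruthFunctor.over H.K-truth)
    open TruthFunctorProperties H.U-fibration H.K-truth
    open ComprehensionProperties H.U-fibration H.K-truth H.adj
    open ≡-Reasoning

  unitₐ : ∀ X → X Ba.⇒ Ca.F₀ (Ka.F₀ X)
  unitₐ X = Fr.toFibreHom {x = X} {Ca.F₀ (Ka.F₀ X)} (adj.unit (proj₁ X)) (H.unit-vertical (proj₁ X))

  adjₐ : Adjunction Ka Cmpa
  adjₐ = record
    { unit = unitₐ
    ; counit = εa
    ; unit-natural = λ {X} {X'} f → fibre-ext r {x = X} {Ca.F₀ (Ka.F₀ X')} (adj.unit-natural (FibreHom.mor f))
    ; counit-natural = λ {Y} {Y'} g → fibre-ext rU {x = Ka.F₀ (Ca.F₀ Y)} {Y'} (adj.counit-natural (FibreHom.mor g))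
    ; zig = λ X → fibre-ext rU {x = Ka.F₀ X} {Ka.F₀ X} (adj.zig (proj₁ X))
    ; zag = λ Y → fibre-ext r {x = Ca.F₀ Y} {Ca.F₀ Y} (adj.zag (proj₁ Y))
    }

  KaPreservingLifting-sound : (F : Functor Ba Ba) (G : Functor Ea Ea) (L : KaPreservingLifting F G) →
                              SoundInductionRule F G L
  KaPreservingLifting-sound F G L X α initial =
    -- The two algebra structures on K_a X have the same underlying morphism; going through fibre-ext
    -- spares the conversion checker a very slow comparison of their proof components.
    subst (IsInitialAlgebra Ea G (Ka.F₀ X)) (fibre-ext rU refl)
      (LiftedInitialAlgebra.left-adjoint-preserves-initial-algebras adjₐ F G
        (KaPreservingLifting.iso {F = F} {G = G} L) α initial)

  UaKa⇒id : ∀ X → Ua.F₀ (Ka.F₀ X) Ba.⇒ X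
  UaKa⇒id X = Fr.toFibreHom {x = Ua.F₀ (Ka.F₀ X)} {X} (B.≡⇒ (over.eq₀ (proj₁ X)))
                (Fr.vertical-≡⇒ (over.eq₀ (proj₁ X)))

  -- A lifting G with G P = Σ_{F π_P} K_a F {P}_a, for any choice of cocartesian lifts c_P, and with U_a G = F U_a.
  module ΣLifting (F : Functor Ba Ba) (G : Functor Ea Ea)
    (lifts₀ : ∀ P → U.F₀ (proj₁ (Functor.F₀ G P)) ≡ proj₁ (Functor.F₀ F (Ua.F₀ P)))
    (c : ∀ P → K.F₀ (proj₁ (Functor.F₀ F (Ca.F₀ P))) E.⇒ proj₁ (Functor.F₀ G P))
    (c-cocartesian : ∀ P → IsCocartesian U (c P))
    (c-over : ∀ P → B.≡⇒ (lifts₀ P) B.∘ U.F₁ (c P)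
                    ≡ FibreHom.mor (Functor.F₁ F (πmor P)) B.∘ B.≡⇒ (over.eq₀ (proj₁ (Functor.F₀ F (Ca.F₀ P)))))
    (lifts₁ : ∀ {P Q} (h : P Ea.⇒ Q) → U.F₁ (FibreHom.mor (Functor.F₁ G h))
                ≡ B.≡⇒ (sym (lifts₀ Q)) B.∘ (FibreHom.mor (Functor.F₁ F (Ua.F₁ h)) B.∘ B.≡⇒ (lifts₀ P)))
    where
    private
      module F = Functor F
      module G = Functor G

    G-lifts : (Ua ∘F G) ≃F (F ∘F Ua)
    G-lifts = record
      { eq₀ = λ P → Fr.FibreObj-≡ {x = Ua.F₀ (G.F₀ P)} {F.F₀ (Ua.F₀ P)} (lifts₀ P)
      ; eq₁ = λ {P} {Q} h → fibre-ext r (begin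
          FibreHom.mor (Ba.≡⇒ (Fr.FibreObj-≡ (lifts₀ Q))) B.∘ U.F₁ (FibreHom.mor (G.F₁ h))
        ≡⟨ cong₂ B._∘_ (Fr.mor-≡⇒ (lifts₀ Q)) (lifts₁ h) ⟩
          B.≡⇒ (lifts₀ Q) B.∘ (B.≡⇒ (sym (lifts₀ Q)) B.∘ (FibreHom.mor (F.F₁ (Ua.F₁ h)) B.∘ B.≡⇒ (lifts₀ P)))
        ≡⟨ CategoryProperties.cancel-sectionˡ B _ (BL.≡⇒-symʳ (lifts₀ Q)) ⟩
          FibreHom.mor (F.F₁ (Ua.F₁ h)) B.∘ B.≡⇒ (lifts₀ P)
        ≡⟨ cong (FibreHom.mor (F.F₁ (Ua.F₁ h)) B.∘_) (sym (Fr.mor-≡⇒ (lifts₀ P))) ⟩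
          FibreHom.mor (F.F₁ (Ua.F₁ h)) B.∘ FibreHom.mor (Ba.≡⇒ (Fr.FibreObj-≡ (lifts₀ P)))
        ∎)
      }

    cₐ : ∀ P → Ka.F₀ (F.F₀ (Ca.F₀ P)) Ea.⇒ G.F₀ P
    cₐ P = FrU.toFibreHom {x = Ka.F₀ (F.F₀ (Ca.F₀ P))} {G.F₀ P} (c P) c-vertical
      where
      c-vertical : IsVertical r (U.F₁ (c P))
      c-vertical = Fr.vertical-cancelˡ
        (CatLemmas.path-resp A (cong r.F₁ (sym (c-over P)))
          (Fr.vertical-∘ (fibre-toPath r (F.F₁ (πmor P))) (Fr.vertical-≡⇒ (over.eq₀ (proj₁ (F.F₀ (Ca.F₀ P)))))))
        (Fr.vertical-≡⇒ (lifts₀ P))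

    -- η is the transpose of F ρ along U_a ⊣ K_a; c_P ∘ K_a F u inverts it when ρ ∘ π_P is invertible.
    module Transpose (P : Ea.Obj) {X : Ba.Obj} (ρ : Ua.F₀ P Ba.⇒ X) where
      η : G.F₀ P Ea.⇒ Ka.F₀ (F.F₀ X)
      η = FrU.toFibreHom {x = G.F₀ P} {Ka.F₀ (F.F₀ X)} (toTruth u)
            (toTruth-vertical r u (Fr.vertical-∘ (fibre-toPath r (F.F₁ ρ)) (Fr.vertical-≡⇒ (lifts₀ P))))
        where u = FibreHom.mor (F.F₁ ρ) B.∘ B.≡⇒ (lifts₀ P)

      private
        η₀ = FibreHom.mor η
        Fρ = FibreHom.mor (F.F₁ ρ)
        Fπ = FibreHom.mor (F.F₁ (πmor P))
        e₀ = over.eq₀ (proj₁ (F.F₀ (Ca.F₀ P)))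

      base-η : base η₀ ≡ Fρ B.∘ B.≡⇒ (lifts₀ P)
      base-η = base-toTruth _

      η-c : η₀ E.∘ c P ≡ K.F₁ (FibreHom.mor (F.F₁ (ρ Ba.∘ πmor P)))
      η-c = base-injective (begin
          base (η₀ E.∘ c P)                                  ≡⟨ base-∘ η₀ (c P) ⟩
          base η₀ B.∘ U.F₁ (c P)                             ≡⟨ cong (B._∘ U.F₁ (c P)) base-η ⟩
          (Fρ B.∘ B.≡⇒ (lifts₀ P)) B.∘ U.F₁ (c P)            ≡⟨ B.assoc ⟩
          Fρ B.∘ (B.≡⇒ (lifts₀ P) B.∘ U.F₁ (c P))            ≡⟨ cong (Fρ B.∘_) (c-over P) ⟩
          Fρ B.∘ (Fπ B.∘ B.≡⇒ e₀)                            ≡⟨ sym B.assoc ⟩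
          (Fρ B.∘ Fπ) B.∘ B.≡⇒ e₀                            ≡⟨ cong (λ k → FibreHom.mor k B.∘ B.≡⇒ e₀)
                                                                (sym (F.homomorphism {f = πmor P} {g = ρ})) ⟩
          FibreHom.mor (F.F₁ (ρ Ba.∘ πmor P)) B.∘ B.≡⇒ e₀    ≡⟨ sym (over.eq₁ _) ⟩
          base (K.F₁ (FibreHom.mor (F.F₁ (ρ Ba.∘ πmor P))))  ∎)

      module Inverse (u : X Ba.⇒ Ca.F₀ P)
                     (ρπ-u : (FibreHom.mor ρ B.∘ FibreHom.mor (πmor P)) B.∘ FibreHom.mor u ≡ B.id)
                     (u-ρπ : FibreHom.mor u B.∘ (FibreHom.mor ρ B.∘ FibreHom.mor (πmor P)) ≡ B.id)
                     (π-u-ρ : FibreHom.mor (πmor P) B.∘ (FibreHom.mor u B.∘ FibreHom.mor ρ) ≡ B.id) where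
        η⁻¹ : Ka.F₀ (F.F₀ X) Ea.⇒ G.F₀ P
        η⁻¹ = cₐ P Ea.∘ Ka.F₁ (F.F₁ u)

        private
          Fu = FibreHom.mor (F.F₁ u)
          Fρπ = FibreHom.mor (F.F₁ (ρ Ba.∘ πmor P))
          η⁻¹₀ = FibreHom.mor η⁻¹

        η-η⁻¹ : η Ea.∘ η⁻¹ ≡ Ea.id
        η-η⁻¹ = fibre-ext rU (begin
            η₀ E.∘ (c P E.∘ K.F₁ Fu)     ≡⟨ sym E.assoc ⟩
            (η₀ E.∘ c P) E.∘ K.F₁ Fu     ≡⟨ cong (E._∘ K.F₁ Fu) η-c ⟩
            K.F₁ Fρπ E.∘ K.F₁ Fu         ≡⟨ sym K.homomorphism ⟩
            K.F₁ (Fρπ B.∘ Fu)            ≡⟨ cong (λ k → K.F₁ (FibreHom.mor k))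
                                              (FunctorProperties.F-resp-inverse F {f = u} {g = ρ Ba.∘ πmor P} (fibre-ext r ρπ-u)) ⟩
            K.F₁ B.id                    ≡⟨ K.identity ⟩
            E.id                         ∎)

        η⁻¹-η-c : (η⁻¹₀ E.∘ η₀) E.∘ c P ≡ E.id E.∘ c P
        η⁻¹-η-c = begin
            ((c P E.∘ K.F₁ Fu) E.∘ η₀) E.∘ c P     ≡⟨ E.assoc ⟩
            (c P E.∘ K.F₁ Fu) E.∘ (η₀ E.∘ c P)     ≡⟨ cong ((c P E.∘ K.F₁ Fu) E.∘_) η-c ⟩
            (c P E.∘ K.F₁ Fu) E.∘ K.F₁ Fρπ         ≡⟨ E.assoc ⟩
            c P E.∘ (K.F₁ Fu E.∘ K.F₁ Fρπ)         ≡⟨ cong (c P E.∘_) (sym K.homomorphism) ⟩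
            c P E.∘ K.F₁ (Fu B.∘ Fρπ)              ≡⟨ cong (λ k → c P E.∘ K.F₁ (FibreHom.mor k))
                                                        (FunctorProperties.F-resp-inverse F {f = ρ Ba.∘ πmor P} {g = u} (fibre-ext r u-ρπ)) ⟩
            c P E.∘ K.F₁ B.id                      ≡⟨ cong (c P E.∘_) K.identity ⟩
            c P E.∘ E.id                           ≡⟨ E.identityʳ ⟩
            c P                                    ≡⟨ sym E.identityˡ ⟩
            E.id E.∘ c P                           ∎

        Fπ-Fu-Fρ : Fπ B.∘ (Fu B.∘ Fρ) ≡ B.id
        Fπ-Fu-Fρ = cong FibreHom.mor (trans (cong (F.F₁ (πmor P) Ba.∘_) (sym (F.homomorphism {f = ρ} {g = u})))
                                       (FunctorProperties.F-resp-inverse F {f = u Ba.∘ ρ} {g = πmor P} (fibre-ext r π-u-ρ)))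

        U-η⁻¹-η : U.F₁ (η⁻¹₀ E.∘ η₀) ≡ U.F₁ E.id
        U-η⁻¹-η = CategoryProperties.≡⇒-cancelˡ B (lifts₀ P) (begin
            w B.∘ U.F₁ ((c P E.∘ K.F₁ Fu) E.∘ η₀)       ≡⟨ cong (λ k → w B.∘ U.F₁ k) E.assoc ⟩
            w B.∘ U.F₁ (c P E.∘ (K.F₁ Fu E.∘ η₀))       ≡⟨ cong (w B.∘_) U.homomorphism ⟩
            w B.∘ (U.F₁ (c P) B.∘ U.F₁ (K.F₁ Fu E.∘ η₀)) ≡⟨ sym B.assoc ⟩
            (w B.∘ U.F₁ (c P)) B.∘ U.F₁ (K.F₁ Fu E.∘ η₀) ≡⟨ cong (B._∘ U.F₁ (K.F₁ Fu E.∘ η₀)) (c-over P) ⟩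
            (Fπ B.∘ B.≡⇒ e₀) B.∘ U.F₁ (K.F₁ Fu E.∘ η₀)  ≡⟨ B.assoc ⟩
            Fπ B.∘ base (K.F₁ Fu E.∘ η₀)                ≡⟨ cong (Fπ B.∘_) (trans (base-K∘ Fu η₀) (cong (Fu B.∘_) base-η)) ⟩
            Fπ B.∘ (Fu B.∘ (Fρ B.∘ w))                  ≡⟨ cong (Fπ B.∘_) (sym B.assoc) ⟩
            Fπ B.∘ ((Fu B.∘ Fρ) B.∘ w)                  ≡⟨ sym B.assoc ⟩
            (Fπ B.∘ (Fu B.∘ Fρ)) B.∘ w                  ≡⟨ cong (B._∘ w) Fπ-Fu-Fρ ⟩
            B.id B.∘ w                                  ≡⟨ B.identityˡ ⟩
            w                                           ≡⟨ sym B.identityʳ ⟩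
            w B.∘ B.id                                  ≡⟨ cong (w B.∘_) (sym U.identity) ⟩
            w B.∘ U.F₁ E.id                             ∎)
          where w = B.≡⇒ (lifts₀ P)

        η⁻¹-η : η⁻¹ Ea.∘ η ≡ Ea.id
        η⁻¹-η = fibre-ext rU (FibreProperties.cocartesian-unique U (c-cocartesian P) U-η⁻¹-η η⁻¹-η-c)

    open Transpose using (η; base-η)

    η-natural : ∀ {P Q X Y} (ρX : Ua.F₀ P Ba.⇒ X) (ρY : Ua.F₀ Q Ba.⇒ Y) (f : X Ba.⇒ Y) (h : P Ea.⇒ Q) →
                FibreHom.mor ρY B.∘ U.F₁ (FibreHom.mor h) ≡ FibreHom.mor f B.∘ FibreHom.mor ρX →
                η Q ρY Ea.∘ G.F₁ h ≡ Ka.F₁ (F.F₁ f) Ea.∘ η P ρX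
    η-natural {P} {Q} ρX ρY f h ρ-square = fibre-ext rU (base-injective (begin
        base (ηY E.∘ FibreHom.mor (G.F₁ h))                    ≡⟨ base-∘ ηY _ ⟩
        base ηY B.∘ U.F₁ (FibreHom.mor (G.F₁ h))               ≡⟨ cong₂ B._∘_ (base-η Q ρY) (lifts₁ h) ⟩
        (FρY B.∘ B.≡⇒ (lifts₀ Q)) B.∘ (B.≡⇒ (sym (lifts₀ Q)) B.∘ (Fh B.∘ B.≡⇒ (lifts₀ P)))
                                                               ≡⟨ CategoryProperties.≡⇒-sym-cancel B (lifts₀ Q) FρY _ ⟩
        FρY B.∘ (Fh B.∘ B.≡⇒ (lifts₀ P))                       ≡⟨ sym B.assoc ⟩
        (FρY B.∘ Fh) B.∘ B.≡⇒ (lifts₀ P)                       ≡⟨ cong (λ k → FibreHom.mor k B.∘ B.≡⇒ (lifts₀ P))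
                                                                   (FunctorProperties.F-resp-square F
                                                                     {f = Ua.F₁ h} {g = ρY} {k = ρX} {h = f} (fibre-ext r ρ-square)) ⟩
        (Ff B.∘ FρX) B.∘ B.≡⇒ (lifts₀ P)                       ≡⟨ B.assoc ⟩
        Ff B.∘ (FρX B.∘ B.≡⇒ (lifts₀ P))                       ≡⟨ cong (Ff B.∘_) (sym (base-η P ρX)) ⟩
        Ff B.∘ base ηX                                         ≡⟨ sym (base-K∘ Ff ηX) ⟩
        base (K.F₁ Ff E.∘ ηX)                                  ∎))
      where
      ηX = FibreHom.mor (η P ρX)
      ηY = FibreHom.mor (η Q ρY)
      FρX = FibreHom.mor (F.F₁ ρX)
      FρY = FibreHom.mor (F.F₁ ρY)
      Ff = FibreHom.mor (F.F₁ f)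
      Fh = FibreHom.mor (F.F₁ (Ua.F₁ h))

    Ka-preserving : KaPreservingLifting F G
    Ka-preserving = record
      { lifts = G-lifts
      ; iso = record
        { η = λ X → η (Ka.F₀ X) (UaKa⇒id X)
        ; η⁻¹ = λ X → Iso.η⁻¹ X
        ; commute = λ {X} {Y} f →
            fibre-ext rU (cong FibreHom.mor (η-natural (UaKa⇒id X) (UaKa⇒id Y) f (Ka.F₁ f) (over.eq₁ (FibreHom.mor f))))
        ; isoˡ = λ X → Iso.η⁻¹-η X
        ; isoʳ = λ X → Iso.η-η⁻¹ X
        }
      }
      where
      module Iso (X : Ba.Obj) = Transpose.Inverse (Ka.F₀ X) (UaKa⇒id X) (unitₐ X)
                                  (πK-unit (proj₁ X)) (unit-πK (proj₁ X)) (π-unit (proj₁ X))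

  private
    -- the cocartesian lift chosen by I_a in FibreData; with it the data below are definitionally those of canonicalLifting
    module CanonicalΣ (F : Functor Ba Ba) (P : Ea.Obj) where
      X₀ = proj₁ (Functor.F₀ F (Ca.F₀ P))
      lift = H.U-opfibration (K.F₀ X₀) (FibreHom.mor (Functor.F₁ F (πmor P)) B.∘ B.≡⇒ (over.eq₀ X₀))

  canonicalLifting-Ka-preserving : (F : Functor Ba Ba) → KaPreservingLifting F (canonicalLifting F)
  canonicalLifting-Ka-preserving F = ΣLifting.Ka-preserving F (canonicalLifting F)
    (λ P → proj₁ (proj₂ (proj₂ (proj₂ (lift P)))))
    (λ P → proj₁ (proj₂ (lift P)))
    (λ P → proj₁ (proj₂ (proj₂ (lift P))))
    (λ P → proj₂ (proj₂ (proj₂ (proj₂ (lift P)))))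
    (λ {P} h → proj₁ (proj₁ (proj₂ (proj₁ (proj₂ (proj₂ (lift P))) _ _ _))))
    where open CanonicalΣ F using (lift)

corollary6p6 : ∀ {oA ℓA oB ℓB oE ℓE} {A : Category oA ℓA} {B : Category oB ℓB} {E : Category oE ℓE}
    (r : Functor B A) (U : Functor E B) → IsFibration r → (H : IsFibredLawvere r U) →
    (a : Category.Obj A) (F : Functor (Fibre r a) (Fibre r a)) (μF : Category.Obj (Fibre r a))
    (inF : Category._⇒_ (Fibre r a) (Functor.F₀ F μF) μF) → IsInitialAlgebra (Fibre r a) F μF inF →
    ((G : Functor (Fibre (r ∘F U) a) (Fibre (r ∘F U) a)) (L : FibreData.KaPreservingLifting r U H a F G) →
    FibreData.SoundInductionRule r U H a F G L)
    × Σ[ L ∈ FibreData.KaPreservingLifting r U H a F (FibreData.canonicalLifting r U H a F) ]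
    FibreData.SoundInductionRule r U H a F (FibreData.canonicalLifting r U H a F) L
corollary6p6 r U _ H a F _ _ _ =
  KaPreservingLifting-sound F , canonicalLifting-Ka-preserving F ,
  KaPreservingLifting-sound F (canonicalLifting F) (canonicalLifting-Ka-preserving F)
  where open FibredLawvereProperties r U H a
        open FibreData r U H a using (canonicalLifting)
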